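{- Let $X\in\{\mathrm{K4\times S5},\mathrm{S4\times S5},\mathrm{SSL}\}$, let $\varphi$ be a bimodal formula, let $\mathcal{F}_0$ be an $X$-tableau-cloud with respect to $\varphi$, and let $\mathfrak{T}$ be a partial $X$-tableau for $(\varphi,\mathcal{F}_0)$. Define $M_{\mathfrak{T}}=(W,\stackrel{\Diamond}{\to},\stackrel{L}{\to},\sigma)$ by $W=\{(\mathcal{F},F):\mathcal{F}\in\mathfrak{T},\ F\in\mathcal{F}\}$; $(\mathcal{F},F)\stackrel{\Diamond}{\to}(\mathcal{G},G)$ iff $\mathcal{F}\leq_X\mathcal{G}$ and $F\preccurlyeq_X G$; $(\mathcal{F},F)\stackrel{L}{\to}(\mathcal{G},G)$ iff $\mathcal{F}=\mathcal{G}$; $\sigma(A)=\{(\mathcal{F},F)\in W:A\in F\}$ for $A\in AT$. Then (1) $M_{\mathfrak{T}}$ is an $X$-model, and (2) for all $\psi\in\mathrm{sf}(\varphi)$ and all $(\mathcal{F},F)\in W$: $M_{\mathfrak{T}},(\mathcal{F},F)\models\psi$ iff $\psi\in F$.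
   Context: Bimodal formulas are built from propositional variables (set $AT$) by $\neg$, $\wedge$, $K$, $\Box$. $\mathrm{sf}(\varphi)$ is the set of subformulas; $\mathcal{L}_\Box$ (resp. $\mathcal{L}_K$) is the set of formulas of the form $\Box\chi$ (resp. $K\chi$). Models: $M=(W,\stackrel{\Diamond}{\to},\stackrel{L}{\to},\sigma)$, $\sigma:AT\to\mathcal{P}(W)$, usual semantics ($\Box$ over $\stackrel{\Diamond}{\to}$-successors, $K$ over $\stackrel{L}{\to}$-successors). Left commutativity: if $w\stackrel{\Diamond}{\to}u\stackrel{L}{\to}u'$ then $w\stackrel{L}{\to}w'\stackrel{\Diamond}{\to}u'$ for some $w'$; right commutativity: if $w\stackrel{L}{\to}w'\stackrel{\Diamond}{\to}u'$ then $w\stackrel{\Diamond}{\to}u\stackrel{L}{\to}u'$ for some $u$. A $\mathrm{K4\times S5}$-model has $W\ne\emptyset$, $\stackrel{\Diamond}{\to}$ transitive, $\stackrel{L}{\to}$ an equivalence, both commutativities; an $\mathrm{S4\times S5}$-model additionally has $\stackrel{\Diamond}{\to}$ reflexive; an $\mathrm{SSL}$-model has $\stackrel{\Diamond}{\to}$ a preorder, $\stackrel{L}{\to}$ an equivalence, left commutativity, and persistence ($w\stackrel{\Diamond}{\to}v$ implies $w\in\sigma(A)\iff v\in\sigma(A)$ for $A\in AT$). A $\mathrm{K4\times S5}$-tableau-set w.r.t. $\varphi$ is $F\subseteq\mathrm{sf}(\varphi)$ with (a) $\neg\chi\in F\iff\chi\notin F$; (b) $(\chi_1\wedge\chi_2)\in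 F\iff\chi_1,\chi_2\in F$; (c) $K\chi\in F\Rightarrow\chi\in F$ (for formulas in $\mathrm{sf}(\varphi)$); $\mathrm{S4\times S5}$-/$\mathrm{SSL}$-tableau-sets also satisfy (d) $\Box\chi\in F\Rightarrow\chi\in F$. $\mathcal{T}^X_\varphi$ = set of $X$-tableau-sets. An $X$-tableau-cloud is $\mathcal{F}\subseteq\mathcal{T}^X_\varphi$ with $F\cap\mathcal{L}_K=G\cap\mathcal{L}_K$ for $F,G\in\mathcal{F}$ and, for $K\chi\in\mathrm{sf}(\varphi)$, $\chi\in\bigcap\mathcal{F}\Rightarrow K\chi\in\bigcap\mathcal{F}$. $\mathfrak{C}^X_\varphi$ = set of clouds. $F\preccurlyeq_X G$: for $\mathrm{K4\times S5}$, $F\cap\mathcal{L}_\Box\subseteq G$ and $\{\psi:\Box\psi\in F\}\subseteq G$; for $\mathrm{S4\times S5}$, $F\cap\mathcal{L}_\Box\subseteq G$; for $\mathrm{SSL}$, $F\cap\mathcal{L}_\Box\subseteq G$ and $F\cap AT=G\cap AT$. $\mathcal{F}\leq_X\mathcal{G}$: every $G\in\mathcal{G}$ has $F\in\mathcal{F}$ with $F\preccurlyeq_X G$, and (only for $X\neq\mathrm{SSL}$) every $F\in\mathcal{F}$ has $G\in\mathcal{G}$ with $F\preccurlyeq_X G$. A partial $X$-tableau for $(\varphi,\mathcal{F}_0)$ is a set $\mathfrak{T}\subseteq\mathfrak{C}^X_\varphi$ with $\mathcal{F}_0\in\mathfrak{T}$ such that for all $\mathcal{F}\in\mathfrak{T}$,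 all $F\in\mathcal{F}$ and all $\chi$ with $\Box\chi\in\mathrm{sf}(\varphi)\setminus F$ there are $\mathcal{G}\in\mathfrak{T}$ with $\mathcal{F}\leq_X\mathcal{G}$ and $G\in\mathcal{G}$ with $F\preccurlyeq_X G$ and $\chi\notin G$. -}

module Defs where

open import Level using (Level; _⊔_; Lift) renaming (suc to lsuc; zero to lzero)
open import Data.Nat using (ℕ)
open import Data.Bool using (Bool; true; false)
open import Data.Product using (Σ; _×_; _,_; proj₁; proj₂)
open import Data.Unit using (⊤)
open import Relation.Nullary using (¬_)
open import Relation.Binary.PropositionalEquality using (_≡_)
open import Function.Bundles using (_⇔_)

AT : Set
AT = ℕ

data Fm : Set where
  var  : AT → Fm
  ¬'_  : Fm → Fm
  _∧'_ : Fm → Fm → Fm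
  K    : Fm → Fm
  □    : Fm → Fm

data _≼_ : Fm → Fm → Set where
  here : ∀ {φ} → φ ≼ φ
  in¬  : ∀ {ψ φ} → ψ ≼ φ → ψ ≼ (¬' φ)
  in∧ˡ : ∀ {ψ φ₁ φ₂} → ψ ≼ φ₁ → ψ ≼ (φ₁ ∧' φ₂)
  in∧ʳ : ∀ {ψ φ₁ φ₂} → ψ ≼ φ₂ → ψ ≼ (φ₁ ∧' φ₂)
  inK  : ∀ {ψ φ} → ψ ≼ φ → ψ ≼ K φ
  in□  : ∀ {ψ φ} → ψ ≼ φ → ψ ≼ □ φ

record Model (a ℓ : Level) : Set (lsuc (a ⊔ ℓ)) where
  field
    W  : Set a
    R◇ : W → W → Set ℓ
    RL : W → W → Set ℓ
    σ  : AT → W → Set ℓ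

module _ {a ℓ : Level} (M : Model a ℓ) where
  open Model M

  infix 4 _⊨_
  _⊨_ : W → Fm → Set (a ⊔ ℓ)
  w ⊨ var A    = Lift a (σ A w)
  w ⊨ (¬' ψ)   = ¬ (w ⊨ ψ)
  w ⊨ (ψ ∧' χ) = (w ⊨ ψ) × (w ⊨ χ)
  w ⊨ K ψ      = ∀ v → RL w v → v ⊨ ψ
  w ⊨ □ ψ      = ∀ v → R◇ w v → v ⊨ ψ

data Logic : Set where
  K4×S5 S4×S5 SSL : Logic

module _ {a ℓ : Level} (M : Model a ℓ) where
  open Model M

  Transitive◇ : Set (a ⊔ ℓ)
  Transitive◇ = ∀ u v w → R◇ u v → R◇ v w → R◇ u w

  Reflexive◇ : Set (a ⊔ ℓ)
  Reflexive◇ = ∀ w → R◇ w w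

  LeftComm : Set (a ⊔ ℓ)
  LeftComm = ∀ w u u' → R◇ w u → RL u u' → Σ W λ w' → RL w w' × R◇ w' u'

  RightComm : Set (a ⊔ ℓ)
  RightComm = ∀ w w' u' → RL w w' → R◇ w' u' → Σ W λ u → R◇ w u × RL u u'

  Persistence : Set (a ⊔ ℓ)
  Persistence = ∀ w v → R◇ w v → ∀ A → σ A w ⇔ σ A v

  record IsEquivalenceL : Set (a ⊔ ℓ) where
    field
      reflL  : ∀ w → RL w w
      symL   : ∀ w v → RL w v → RL v w
      transL : ∀ u v w → RL u v → RL v w → RL u w

  ExtraConds : Logic → Set (a ⊔ ℓ)
  ExtraConds K4×S5 = Transitive◇ × RightComm
  ExtraConds S4×S5 = Transitive◇ × Reflexive◇ × RightComm
  ExtraConds SSL   = Transitive◇ × Reflexive◇ × Persistence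

  record IsModel (X : Logic) : Set (a ⊔ ℓ) where
    field
      inhabited : W
      equivL    : IsEquivalenceL
      leftComm  : LeftComm
      extra     : ExtraConds X

-- Sets of formulas (decidable: characteristic functions), clouds, tableaux

FSet : Set
FSet = Fm → Bool

infix 4 _∈_
_∈_ : Fm → FSet → Set
ψ ∈ F = F ψ ≡ true

Box-T : Logic → Fm → FSet → Set
Box-T K4×S5 φ F = ⊤
Box-T S4×S5 φ F = ∀ χ → □ χ ≼ φ → □ χ ∈ F → χ ∈ F
Box-T SSL   φ F = ∀ χ → □ χ ≼ φ → □ χ ∈ F → χ ∈ F

record IsTableauSet (X : Logic) (φ : Fm) (F : FSet) : Set where
  field
    ⊆sf  : ∀ ψ → ψ ∈ F → ψ ≼ φ
    neg  : ∀ χ → (¬' χ) ≼ φ → ((¬' χ) ∈ F ⇔ (¬ (χ ∈ F)))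
    conj : ∀ χ₁ χ₂ → (χ₁ ∧' χ₂) ≼ φ → ((χ₁ ∧' χ₂) ∈ F ⇔ (χ₁ ∈ F × χ₂ ∈ F))
    K-T  : ∀ χ → K χ ≼ φ → K χ ∈ F → χ ∈ F
    box  : Box-T X φ F

Cloud : Set₁
Cloud = FSet → Set

record IsCloud (X : Logic) (φ : Fm) (𝓕 : Cloud) : Set where
  field
    tabsets : ∀ F → 𝓕 F → IsTableauSet X φ F
    sameK   : ∀ F G → 𝓕 F → 𝓕 G → ∀ χ → F (K χ) ≡ G (K χ)
    closeK  : ∀ χ → K χ ≼ φ → (∀ F → 𝓕 F → χ ∈ F) → ∀ F → 𝓕 F → K χ ∈ F

_⊢_≼ₓ_ : Logic → FSet → FSet → Set
K4×S5 ⊢ F ≼ₓ G = (∀ χ → □ χ ∈ F → □ χ ∈ G) × (∀ χ → □ χ ∈ F → χ ∈ G)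
S4×S5 ⊢ F ≼ₓ G = ∀ χ → □ χ ∈ F → □ χ ∈ G
SSL   ⊢ F ≼ₓ G = (∀ χ → □ χ ∈ F → □ χ ∈ G) × (∀ A → F (var A) ≡ G (var A))

BackCond : Logic → Cloud → Cloud → Set
BackCond SSL   𝓕 𝓖 = ⊤
BackCond K4×S5 𝓕 𝓖 = ∀ F → 𝓕 F → Σ FSet λ G → 𝓖 G × (K4×S5 ⊢ F ≼ₓ G)
BackCond S4×S5 𝓕 𝓖 = ∀ F → 𝓕 F → Σ FSet λ G → 𝓖 G × (S4×S5 ⊢ F ≼ₓ G)

_⊢_≤ₓ_ : Logic → Cloud → Cloud → Set
X ⊢ 𝓕 ≤ₓ 𝓖 = (∀ G → 𝓖 G → Σ FSet λ F → 𝓕 F × (X ⊢ F ≼ₓ G)) × BackCond X 𝓕 𝓖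

Tableau : Set₂
Tableau = Cloud → Set₁

record IsPartialTableau (X : Logic) (φ : Fm) (𝓕₀ : Cloud) (𝔗 : Tableau) : Set₁ where
  field
    clouds  : ∀ 𝓕 → 𝔗 𝓕 → IsCloud X φ 𝓕
    initial : 𝔗 𝓕₀
    witness : ∀ 𝓕 → 𝔗 𝓕 → ∀ F → 𝓕 F → ∀ χ → □ χ ≼ φ → ¬ (□ χ ∈ F) →
              Σ Cloud λ 𝓖 → 𝔗 𝓖 × (X ⊢ 𝓕 ≤ₓ 𝓖) ×
                Σ FSet λ G → 𝓖 G × (X ⊢ F ≼ₓ G) × ¬ (χ ∈ G)

record World (𝔗 : Tableau) : Set₁ where
  constructor world
  field
    cloud   : Cloud
    cloud∈  : 𝔗 cloud
    tset    : FSet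
    tset∈   : cloud tset

open World public

_≈ᶜ_ : Cloud → Cloud → Set
𝓕 ≈ᶜ 𝓖 = ∀ F → (𝓕 F → 𝓖 F) × (𝓖 F → 𝓕 F)

M[_,_] : Logic → Tableau → Model (lsuc lzero) lzero
M[ X , 𝔗 ] = record
  { W  = World 𝔗
  ; R◇ = λ w v → (X ⊢ cloud w ≤ₓ cloud v) × (X ⊢ tset w ≼ₓ tset v)
  ; RL = λ w v → cloud w ≈ᶜ cloud v
  ; σ  = λ A w → var A ∈ tset w
  }

module Submission where

-- The frame conditions of an
-- X-model then hold for the structure built from ANY set of clouds 𝔗:
-- left commutativity uses the "every G has a predecessor" half of ≤ₓ, right
-- commutativity its "every F has a successor" half (present unless X = SSL),
-- and persistence for SSL is built into ≼ₓ.
--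
-- For a partial tableau, ψ holds at (𝓕,F) iff ψ ∈ F, by
-- induction on ψ: ¬ and ∧ by the tableau-set closure conditions, K by the
-- cloud conditions, and □ by the witness condition of the partial tableau
-- (⇒, using that membership is decidable) and by `box-sound` (⇐).

open import Level using (lift; lower)
open import Data.Bool using (true; false)
open import Data.Empty using (⊥-elim)
open import Data.Product using (Σ; _×_; _,_; proj₁; proj₂)
open import Data.Unit using (tt)
open import Function using (id; _∘_)
open import Function.Bundles using (_⇔_; mk⇔; Equivalence)
open import Relation.Nullary using (¬_)
open import Relation.Binary.PropositionalEquality using (_≢_; refl; sym; trans)

open import Defs

open Equivalence using (to; from)

≼-trans : ∀ {ψ χ φ} → ψ ≼ χ → χ ≼ φ → ψ ≼ φ
≼-trans p here     = p
≼-trans p (in¬ q)  = in¬ (≼-trans p q)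
≼-trans p (in∧ˡ q) = in∧ˡ (≼-trans p q)
≼-trans p (in∧ʳ q) = in∧ʳ (≼-trans p q)
≼-trans p (inK q)  = inK (≼-trans p q)
≼-trans p (in□ q)  = in□ (≼-trans p q)

-- Membership in a formula set is decidable, hence stable under double
-- negation; this replaces the classical step in the □-case of the truth lemma.
∈-stable : ∀ ψ (F : FSet) → ¬ ¬ (ψ ∈ F) → ψ ∈ F
∈-stable ψ F with F ψ
... | true  = λ _ → refl
... | false = λ ¬¬ψ∈F → ⊥-elim (¬¬ψ∈F λ ())

≼ₓ-trans : ∀ X {F G H} → X ⊢ F ≼ₓ G → X ⊢ G ≼ₓ H → X ⊢ F ≼ₓ H
≼ₓ-trans K4×S5 (□FG , unboxFG) (□GH , unboxGH) =
  (λ χ → □GH χ ∘ □FG χ) , (λ χ → unboxGH χ ∘ □FG χ)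
≼ₓ-trans S4×S5 □FG □GH = λ χ → □GH χ ∘ □FG χ
≼ₓ-trans SSL (□FG , atFG) (□GH , atGH) =
  (λ χ → □GH χ ∘ □FG χ) , (λ A → trans (atFG A) (atGH A))

-- ≼ₓ is reflexive for the logics with reflexive □ (K4×S5 demands F ∋ χ for
-- □χ ∈ F, which need not hold).
≼ₓ-refl : ∀ X → X ≢ K4×S5 → ∀ F → X ⊢ F ≼ₓ F
≼ₓ-refl K4×S5 X≢K4 F = ⊥-elim (X≢K4 refl)
≼ₓ-refl S4×S5 _    F = λ χ → id
≼ₓ-refl SSL   _    F = (λ χ → id) , (λ A → refl)

-- If □χ ∈ F and F ≼ₓ G for a tableau-set G, then χ ∈ G: this is built into
-- ≼ₓ for K4×S5, and follows from the T-condition (d) of G otherwise.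
box-sound : ∀ X φ {F G} χ → □ χ ≼ φ → IsTableauSet X φ G →
            □ χ ∈ F → X ⊢ F ≼ₓ G → χ ∈ G
box-sound K4×S5 φ χ □χ≼φ G-tab □χ∈F (_ , unbox) = unbox χ □χ∈F
box-sound S4×S5 φ χ □χ≼φ G-tab □χ∈F □FG       = IsTableauSet.box G-tab χ □χ≼φ (□FG χ □χ∈F)
box-sound SSL   φ χ □χ≼φ G-tab □χ∈F (□FG , _) = IsTableauSet.box G-tab χ □χ≼φ (□FG χ □χ∈F)

HasPred : Logic → Cloud → Cloud → Set
HasPred X 𝓕 𝓖 = ∀ G → 𝓖 G → Σ FSet λ F → 𝓕 F × (X ⊢ F ≼ₓ G)

HasSucc : Logic → Cloud → Cloud → Set
HasSucc X 𝓕 𝓖 = ∀ F → 𝓕 F → Σ FSet λ G → 𝓖 G × (X ⊢ F ≼ₓ G)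

HasPred-trans : ∀ X {𝓕 𝓖 𝓗} → HasPred X 𝓕 𝓖 → HasPred X 𝓖 𝓗 → HasPred X 𝓕 𝓗
HasPred-trans X predFG predGH H H∈ with predGH H H∈
... | G , G∈ , G≼H with predFG G G∈
... | F , F∈ , F≼G = F , F∈ , ≼ₓ-trans X F≼G G≼H

HasSucc-trans : ∀ X {𝓕 𝓖 𝓗} → HasSucc X 𝓕 𝓖 → HasSucc X 𝓖 𝓗 → HasSucc X 𝓕 𝓗
HasSucc-trans X succFG succGH F F∈ with succFG F F∈
... | G , G∈ , F≼G with succGH G G∈
... | H , H∈ , G≼H = H , H∈ , ≼ₓ-trans X F≼G G≼H

HasPred-resp : ∀ X {𝓕 𝓕' 𝓖 𝓖'} → 𝓕 ≈ᶜ 𝓕' → 𝓖 ≈ᶜ 𝓖' → HasPred X 𝓕 𝓖 → HasPred X 𝓕' 𝓖'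
HasPred-resp X 𝓕≈ 𝓖≈ pred G G∈ with pred G (proj₂ (𝓖≈ G) G∈)
... | F , F∈ , F≼G = F , proj₁ (𝓕≈ F) F∈ , F≼G

HasSucc-resp : ∀ X {𝓕 𝓕' 𝓖 𝓖'} → 𝓕 ≈ᶜ 𝓕' → 𝓖 ≈ᶜ 𝓖' → HasSucc X 𝓕 𝓖 → HasSucc X 𝓕' 𝓖'
HasSucc-resp X 𝓕≈ 𝓖≈ succ F F∈ with succ F (proj₂ (𝓕≈ F) F∈)
... | G , G∈ , F≼G = G , proj₁ (𝓖≈ G) G∈ , F≼G

BackCond-trans : ∀ X {𝓕 𝓖 𝓗} → BackCond X 𝓕 𝓖 → BackCond X 𝓖 𝓗 → BackCond X 𝓕 𝓗
BackCond-trans K4×S5 = HasSucc-trans K4×S5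
BackCond-trans S4×S5 = HasSucc-trans S4×S5
BackCond-trans SSL   = λ _ _ → tt

BackCond-resp : ∀ X {𝓕 𝓕' 𝓖 𝓖'} → 𝓕 ≈ᶜ 𝓕' → 𝓖 ≈ᶜ 𝓖' → BackCond X 𝓕 𝓖 → BackCond X 𝓕' 𝓖'
BackCond-resp K4×S5 = HasSucc-resp K4×S5
BackCond-resp S4×S5 = HasSucc-resp S4×S5
BackCond-resp SSL   = λ _ _ _ → tt

BackCond-refl : ∀ X → (∀ F → X ⊢ F ≼ₓ F) → ∀ 𝓕 → BackCond X 𝓕 𝓕
BackCond-refl K4×S5 refl≼ 𝓕 F F∈ = F , F∈ , refl≼ F
BackCond-refl S4×S5 refl≼ 𝓕 F F∈ = F , F∈ , refl≼ F
BackCond-refl SSL   refl≼ 𝓕     = tt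

≤ₓ-trans : ∀ X {𝓕 𝓖 𝓗} → X ⊢ 𝓕 ≤ₓ 𝓖 → X ⊢ 𝓖 ≤ₓ 𝓗 → X ⊢ 𝓕 ≤ₓ 𝓗
≤ₓ-trans X (predFG , backFG) (predGH , backGH) =
  HasPred-trans X predFG predGH , BackCond-trans X backFG backGH

≤ₓ-resp : ∀ X {𝓕 𝓕' 𝓖 𝓖'} → 𝓕 ≈ᶜ 𝓕' → 𝓖 ≈ᶜ 𝓖' → X ⊢ 𝓕 ≤ₓ 𝓖 → X ⊢ 𝓕' ≤ₓ 𝓖'
≤ₓ-resp X 𝓕≈ 𝓖≈ (pred , back) = HasPred-resp X 𝓕≈ 𝓖≈ pred , BackCond-resp X 𝓕≈ 𝓖≈ back

≤ₓ-refl : ∀ X → (∀ F → X ⊢ F ≼ₓ F) → ∀ 𝓕 → X ⊢ 𝓕 ≤ₓ 𝓕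
≤ₓ-refl X refl≼ 𝓕 = (λ G G∈ → G , G∈ , refl≼ G) , BackCond-refl X refl≼ 𝓕

≈ᶜ-refl : ∀ {𝓕} → 𝓕 ≈ᶜ 𝓕
≈ᶜ-refl F = id , id

≈ᶜ-sym : ∀ {𝓕 𝓖} → 𝓕 ≈ᶜ 𝓖 → 𝓖 ≈ᶜ 𝓕
≈ᶜ-sym 𝓕≈𝓖 F = proj₂ (𝓕≈𝓖 F) , proj₁ (𝓕≈𝓖 F)

≈ᶜ-trans : ∀ {𝓕 𝓖 𝓗} → 𝓕 ≈ᶜ 𝓖 → 𝓖 ≈ᶜ 𝓗 → 𝓕 ≈ᶜ 𝓗
≈ᶜ-trans 𝓕≈𝓖 𝓖≈𝓗 F = proj₁ (𝓖≈𝓗 F) ∘ proj₁ (𝓕≈𝓖 F) , proj₂ (𝓕≈𝓖 F) ∘ proj₂ (𝓖≈𝓗 F)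

module Frame (X : Logic) (𝔗 : Tableau) where

  sibling : (w : World 𝔗) → ∀ G → cloud w G → World 𝔗
  sibling w G G∈ = world (cloud w) (cloud∈ w) G G∈

  equivalenceL : IsEquivalenceL M[ X , 𝔗 ]
  equivalenceL = record
    { reflL  = λ w → ≈ᶜ-refl
    ; symL   = λ w v → ≈ᶜ-sym
    ; transL = λ u v w → ≈ᶜ-trans
    }

  transitive : Transitive◇ M[ X , 𝔗 ]
  transitive u v w (uv-cloud , uv-set) (vw-cloud , vw-set) =
    ≤ₓ-trans X uv-cloud vw-cloud , ≼ₓ-trans X uv-set vw-set

  reflexive : (∀ F → X ⊢ F ≼ₓ F) → Reflexive◇ M[ X , 𝔗 ]
  reflexive refl≼ w = ≤ₓ-refl X refl≼ (cloud w) , refl≼ (tset w)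

  -- w ◇→ u L→ u': the predecessor of tset u' in cloud w gives w'.
  leftComm : LeftComm M[ X , 𝔗 ]
  leftComm w u u' (wu-cloud , _) u≈u' with proj₁ wu-cloud (tset u') (proj₂ (u≈u' (tset u')) (tset∈ u'))
  ... | F , F∈ , F≼u' = sibling w F F∈ , ≈ᶜ-refl , ≤ₓ-resp X ≈ᶜ-refl u≈u' wu-cloud , F≼u'

  -- w L→ w' ◇→ u': the successor of tset w in cloud u' gives u; this needs
  -- the successor half of ≤ₓ.
  rightComm : (∀ {𝓕 𝓖} → BackCond X 𝓕 𝓖 → HasSucc X 𝓕 𝓖) → RightComm M[ X , 𝔗 ]
  rightComm succ w w' u' w≈w' (w'u'-cloud , _)
    with succ (proj₂ w'u'-cloud) (tset w) (proj₁ (w≈w' (tset w)) (tset∈ w))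
  ... | G , G∈ , w≼G =
    sibling u' G G∈ , (≤ₓ-resp X (≈ᶜ-sym w≈w') ≈ᶜ-refl w'u'-cloud , w≼G) , ≈ᶜ-refl

persistence : ∀ 𝔗 → Persistence M[ SSL , 𝔗 ]
persistence 𝔗 w v (_ , (_ , sameAtoms)) A =
  mk⇔ (trans (sym (sameAtoms A))) (trans (sameAtoms A))

frameConditions : ∀ X 𝔗 → ExtraConds M[ X , 𝔗 ] X
frameConditions K4×S5 𝔗 = transitive , rightComm id
  where open Frame K4×S5 𝔗
frameConditions S4×S5 𝔗 = transitive , reflexive (≼ₓ-refl S4×S5 λ ()) , rightComm id
  where open Frame S4×S5 𝔗
frameConditions SSL 𝔗 = transitive , reflexive (≼ₓ-refl SSL λ ()) , persistence 𝔗
  where open Frame SSL 𝔗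

module Truth (X : Logic) (φ : Fm) (𝓕₀ : Cloud) (𝔗 : Tableau) (PT : IsPartialTableau X φ 𝓕₀ 𝔗) where
  open IsPartialTableau PT
  open Frame X 𝔗 using (sibling)

  _⊨'_ : World 𝔗 → Fm → Set₁
  w ⊨' ψ = _⊨_ M[ X , 𝔗 ] w ψ

  tableauSet : (w : World 𝔗) → IsTableauSet X φ (tset w)
  tableauSet w = IsCloud.tabsets (clouds (cloud w) (cloud∈ w)) (tset w) (tset∈ w)

  truth : ∀ ψ → ψ ≼ φ → (w : World 𝔗) → (w ⊨' ψ) ⇔ (ψ ∈ tset w)
  truth (var A) _ w = mk⇔ lower lift
  truth (¬' χ) ¬χ≼φ w = mk⇔
    (λ w⊭χ → from neg (w⊭χ ∘ from ih))
    (λ ¬χ∈F → to neg ¬χ∈F ∘ to ih)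
    where
    neg = IsTableauSet.neg (tableauSet w) χ ¬χ≼φ
    ih  = truth χ (≼-trans (in¬ here) ¬χ≼φ) w
  truth (χ₁ ∧' χ₂) ∧≼φ w = mk⇔
    (λ (w⊨χ₁ , w⊨χ₂) → from conj (to ih₁ w⊨χ₁ , to ih₂ w⊨χ₂))
    (λ ∧∈F → from ih₁ (proj₁ (to conj ∧∈F)) , from ih₂ (proj₂ (to conj ∧∈F)))
    where
    conj = IsTableauSet.conj (tableauSet w) χ₁ χ₂ ∧≼φ
    ih₁  = truth χ₁ (≼-trans (in∧ˡ here) ∧≼φ) w
    ih₂  = truth χ₂ (≼-trans (in∧ʳ here) ∧≼φ) w
  -- K: the L-successors of w are the worlds of the same cloud, which all
  -- contain the same K-formulas and are closed under K-introduction.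
  truth (K χ) Kχ≼φ w = mk⇔ closeK Kχ-sound
    where
    χ≼φ  = ≼-trans (inK here) Kχ≼φ
    cl   = clouds (cloud w) (cloud∈ w)

    closeK : w ⊨' K χ → K χ ∈ tset w
    closeK w⊨Kχ = IsCloud.closeK cl χ Kχ≼φ
      (λ G G∈ → to (truth χ χ≼φ (sibling w G G∈)) (w⊨Kχ (sibling w G G∈) ≈ᶜ-refl))
      (tset w) (tset∈ w)

    Kχ-sound : K χ ∈ tset w → w ⊨' K χ
    Kχ-sound Kχ∈F v w≈v = from (truth χ χ≼φ v)
      (IsTableauSet.K-T (tableauSet v) χ Kχ≼φ
        (trans (sym (IsCloud.sameK cl (tset w) (tset v) (tset∈ w) (proj₂ (w≈v (tset v)) (tset∈ v)) χ)) Kχ∈F))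
  -- □: if □χ ∉ F, the partial tableau supplies a ◇-successor refuting χ.
  truth (□ χ) □χ≼φ w = mk⇔ complete sound
    where
    χ≼φ = ≼-trans (in□ here) □χ≼φ

    complete : w ⊨' □ χ → □ χ ∈ tset w
    complete w⊨□χ = ∈-stable (□ χ) (tset w) λ □χ∉F →
      let (𝓖 , 𝓖∈ , 𝓕≤𝓖 , G , G∈ , F≼G , χ∉G) = witness (cloud w) (cloud∈ w) (tset w) (tset∈ w) χ □χ≼φ □χ∉F
          v = world 𝓖 𝓖∈ G G∈
      in χ∉G (to (truth χ χ≼φ v) (w⊨□χ v (𝓕≤𝓖 , F≼G)))

    sound : □ χ ∈ tset w → w ⊨' □ χ
    sound □χ∈F v (_ , F≼G) = from (truth χ χ≼φ v) (box-sound X φ χ □χ≼φ (tableauSet v) □χ∈F F≼G)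

lemma6p4 : (X : Logic) (φ : Fm) (𝓕₀ : Cloud) → IsCloud X φ 𝓕₀ →
    Σ FSet 𝓕₀ →
    (𝔗 : Tableau) → IsPartialTableau X φ 𝓕₀ 𝔗 →
    IsModel M[ X , 𝔗 ] X ×
    (∀ ψ → ψ ≼ φ → (w : World 𝔗) → (_⊨_ M[ X , 𝔗 ] w ψ ⇔ ψ ∈ tset w))
lemma6p4 X φ 𝓕₀ _ (F₀ , F₀∈) 𝔗 PT = isModel , Truth.truth X φ 𝓕₀ 𝔗 PT
  where
  open Frame X 𝔗 using (equivalenceL; leftComm)

  isModel : IsModel M[ X , 𝔗 ] X
  isModel = record
    { inhabited = world 𝓕₀ (IsPartialTableau.initial PT) F₀ F₀∈
    ; equivL    = equivalenceL
    ; leftComm  = leftComm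
    ; extra     = frameConditions X 𝔗
    }
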